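{- Let $n\ge1$ and let $\sigma$ be a centrosymmetric permutation of $[2n]$. Write $w(\sigma)=\sigma(1)\sigma(2)\cdots\sigma(n)=x_1\,w_1\,x_2\,w_2\cdots x_s\,w_s$ as in the context, let $l_1\ge 0$ be the length of $w_1$, and let $\sigma'$ be the word $\sigma(l_1+2)\,\sigma(l_1+3)\cdots\sigma(2n-l_1-1)$, whose set of entries is $A_1=[2n]\setminus\{x_1,\,2n+1-x_1,\,2n,2n-1,\dots,2n-l_1+1,\,1,2,\dots,l_1\}$ (so that $w(\sigma)=x_1\,w_1\,w(\sigma')$, where $w(\sigma')$ is the first half of $\sigma'$). Then $\sigma$ avoids $123$ if and only if all of the following hold: (i) $x_1\ge n$; (ii) $w_1=2n\,(2n-1)\cdots(2n-l_1+1)$, with $2n-l_1+1>x_1$; (iii) $\sigma'$ is order-isomorphic to a centrosymmetric $123$-avoiding permutation; (iv) the first entry of $\sigma'$ (if $\sigma'$ is nonempty) is less than $x_1$.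
   Context: A permutation $\sigma$ of $[m]=\{1,\dots,m\}$ is centrosymmetric if $\sigma(i)+\sigma(m+1-i)=m+1$ for all $i$; it avoids $123$ if there are no $i<j<k$ with $\sigma(i)<\sigma(j)<\sigma(k)$. For $\sigma$ centrosymmetric of $[2n]$, $w(\sigma)=\sigma(1)\cdots\sigma(n)$. A left-to-right minimum of $\sigma$ is a position $i$ with $\sigma(i)\le\sigma(j)$ for all $j\le i$. Write $w(\sigma)=x_1w_1x_2w_2\cdots x_sw_s$, where $x_1,\dots,x_s$ are the values of the left-to-right minima of $\sigma$ occurring among the first $n$ positions (so $x_1=\sigma(1)$) and each $w_i$ is the (possibly empty) word of entries strictly between $x_i$ and $x_{i+1}$ (or between $x_s$ and the end of $w(\sigma)$). A word with distinct integer entries is order-isomorphic to a permutation $\tau$ of $[r]$ if it has length $r$ and its $i$-th entry is the $\tau(i)$-th smallest of its entries. -}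

module Defs where

open import Data.Nat using (ℕ; zero; suc; _+_; _*_; _∸_; _≤_; _<_; _≤ᵇ_)
open import Data.Product using (Σ; _×_; ∃-syntax)
open import Data.Bool using (if_then_else_)
open import Relation.Binary.PropositionalEquality using (_≡_)
open import Relation.Nullary using (¬_)

-- Permutations / words are written in one-line notation as functions ℕ → ℕ
-- with 1-based positions; only positions 1..m are meaningful.

IsPerm : ℕ → (ℕ → ℕ) → Set
IsPerm m σ =
  (∀ i → 1 ≤ i → i ≤ m → (1 ≤ σ i) × (σ i ≤ m)) ×
  (∀ i j → 1 ≤ i → i ≤ m → 1 ≤ j → j ≤ m → σ i ≡ σ j → i ≡ j) ×
  (∀ v → 1 ≤ v → v ≤ m → ∃[ i ] ((1 ≤ i) × (i ≤ m) × (σ i ≡ v)))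

Centrosymmetric : ℕ → (ℕ → ℕ) → Set
Centrosymmetric m σ = ∀ i → 1 ≤ i → i ≤ m → σ i + σ (m + 1 ∸ i) ≡ m + 1

Avoids123 : ℕ → (ℕ → ℕ) → Set
Avoids123 m σ = ¬ (∃[ i ] ∃[ j ] ∃[ k ]
  ((1 ≤ i) × (i < j) × (j < k) × (k ≤ m) × (σ i < σ j) × (σ j < σ k)))

LRMin : (ℕ → ℕ) → ℕ → Set
LRMin σ i = ∀ j → 1 ≤ j → j ≤ i → σ i ≤ σ j

-- l is the length of w₁ in w(σ) = σ(1)⋯σ(n) = x₁ w₁ x₂ w₂ ⋯ :
-- positions 2,…,l+1 are not left-to-right minima, and either w₁ runs to the
-- end of w(σ) (l+1 = n) or position l+2 is the next left-to-right minimum x₂.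
IsW1Length : (ℕ → ℕ) → ℕ → ℕ → Set
IsW1Length σ n l =
  (l + 1 ≤ n) ×
  (∀ j → 2 ≤ j → j ≤ l + 1 → ¬ LRMin σ j) ×
  ((l + 1 ≡ n) Data.Sum.⊎ LRMin σ (l + 2))
  where import Data.Sum

countLeq : ℕ → (ℕ → ℕ) → ℕ → ℕ
countLeq zero    u v = 0
countLeq (suc r) u v = countLeq r u v + (if u (suc r) ≤ᵇ v then 1 else 0)

-- the word u(1)⋯u(r) is order-isomorphic to τ (a permutation of [r]):
-- its i-th entry is the τ(i)-th smallest of its entries.
OrderIso : ℕ → (ℕ → ℕ) → (ℕ → ℕ) → Set
OrderIso r u τ = ∀ i → 1 ≤ i → i ≤ r → countLeq r u (u i) ≡ τ i

module Submission where

-- Standardization is order-isomorphic to the word, so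
-- both have the same 123 patterns; it is a permutation when the word is injective and is
-- centrosymmetric when u(i) + u(r+1-i) is constant.
--
-- Forward: a small x₁ gives the pattern x₁, x₁+1, σ(m);
-- strong induction shows w₁ consists of the top values, each above x₁; x₂ = σ(l₁+2) is the
-- next left-to-right minimum; σ′ is injective and symmetric, so its standardization is the
-- τ of (iii). Converse: in a 123 pattern of σ the middle entry lies in σ′ (w₁ and its
-- mirror image block it), while x₁ and σ(m) can be replaced by the first and last entries
-- of σ′, so the pattern is pushed into σ′.

open import Defs
open import Data.Nat
open import Data.Nat.Properties
open import Data.Nat.Induction using (<-rec)
open import Data.Nat.Tactic.RingSolver using (solve-∀)
open import Data.Bool using (Bool; true; false; T; _∨_; _∧_; if_then_else_)
open import Data.Bool.Properties using (T-∧; T-∨)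
open import Data.Empty using (⊥-elim)
open import Data.Product using (_×_; _,_; ∃-syntax; proj₁; proj₂)
open import Data.Sum using (_⊎_; inj₁; inj₂)
open import Function using (_∘_)
open import Function.Bundles using (_⇔_; mk⇔; Equivalence)
open import Relation.Nullary using (¬_; yes; no)
open import Relation.Binary.PropositionalEquality
open import Relation.Binary.Definitions using (tri<; tri≈; tri>)
open import Algebra.Properties.CommutativeSemigroup +-commutativeSemigroup using (interchange)

InRange : ℕ → ℕ → Set
InRange r j = (1 ≤ j) × (j ≤ r)

InRange-suc : ∀ {r j} → InRange r j → InRange (suc r) j
InRange-suc (1≤j , j≤r) = 1≤j , m≤n⇒m≤1+n j≤r

InRange-last : ∀ r → InRange (suc r) (suc r)
InRange-last r = s≤s z≤n , ≤-refl

restrict : ∀ {r} {P : ℕ → Set} → (∀ j → InRange (suc r) j → P j) → ∀ j → InRange r j → P j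
restrict h j j∈ = h j (InRange-suc j∈)

InRange-split : ∀ {r j} → InRange (suc r) j → (j ≡ suc r) ⊎ InRange r j
InRange-split (1≤j , j≤r+1) with m≤n⇒m<n∨m≡n j≤r+1
... | inj₁ j<r+1 = inj₂ (1≤j , ≤-pred j<r+1)
... | inj₂ j≡r+1 = inj₁ j≡r+1

+-complement-≤ : ∀ {a b c d} → a + b ≡ c + d → c ≤ a → b ≤ d
+-complement-≤ {a} {b} {c} {d} eq c≤a =
  +-cancelˡ-≤ c b d (≤-trans (+-monoˡ-≤ b c≤a) (≤-reflexive eq))

+-complement-< : ∀ {a b c d} → a + b ≡ c + d → c < a → b < d
+-complement-< {a} {b} {c} {d} eq c<a =
  +-cancelˡ-< c b d (≤-trans (+-monoˡ-< b c<a) (≤-reflexive eq))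

indicator : Bool → ℕ
indicator b = if b then 1 else 0

count : ℕ → (ℕ → Bool) → ℕ
count zero    p = 0
count (suc r) p = count r p + indicator (p (suc r))

countLeq≡count : ∀ r u v → countLeq r u v ≡ count r (λ j → u j ≤ᵇ v)
countLeq≡count zero    u v = refl
countLeq≡count (suc r) u v = cong (_+ indicator (u (suc r) ≤ᵇ v)) (countLeq≡count r u v)

indicator-mono : ∀ a b → (T a → T b) → indicator a ≤ indicator b
indicator-mono false b    _   = z≤n
indicator-mono true  true _   = ≤-refl
indicator-mono true  false a⇒b = ⊥-elim (a⇒b _)

indicator-strict : ∀ a b → ¬ T a → T b → indicator a < indicator b
indicator-strict false true  _  _ = s≤s z≤n
indicator-strict true  _     ¬a _ = ⊥-elim (¬a _)

indicator-≤1 : ∀ a → indicator a ≤ 1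
indicator-≤1 false = z≤n
indicator-≤1 true  = ≤-refl

T-ext : ∀ a b → (T a → T b) → (T b → T a) → a ≡ b
T-ext false false _ _ = refl
T-ext true  true  _ _ = refl
T-ext false true  _ b⇒a = ⊥-elim (b⇒a _)
T-ext true  false a⇒b _ = ⊥-elim (a⇒b _)

count-cong : ∀ r p q → (∀ j → InRange r j → p j ≡ q j) → count r p ≡ count r q
count-cong zero    p q p≡q = refl
count-cong (suc r) p q p≡q =
  cong₂ _+_ (count-cong r p q (restrict p≡q))
            (cong indicator (p≡q (suc r) (InRange-last r)))

count-mono : ∀ r p q → (∀ j → InRange r j → T (p j) → T (q j)) → count r p ≤ count r q
count-mono zero    p q p⇒q = z≤n
count-mono (suc r) p q p⇒q =
  +-mono-≤ (count-mono r p q (restrict p⇒q))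
           (indicator-mono _ _ (p⇒q (suc r) (InRange-last r)))

count-strict : ∀ r p q → (∀ j → InRange r j → T (p j) → T (q j)) →
  ∀ k → InRange r k → ¬ T (p k) → T (q k) → count r p < count r q
count-strict zero    p q p⇒q k (() , z≤n)
count-strict (suc r) p q p⇒q k k∈ ¬pk qk with InRange-split k∈
... | inj₁ refl = +-mono-≤-< (count-mono r p q (restrict p⇒q)) (indicator-strict _ _ ¬pk qk)
... | inj₂ k∈′ = +-mono-<-≤ (count-strict r p q (restrict p⇒q) k k∈′ ¬pk qk)
                            (indicator-mono _ _ (p⇒q (suc r) (InRange-last r)))

count-≤ : ∀ r p → count r p ≤ r
count-≤ zero    p = z≤n
count-≤ (suc r) p =
  subst (count (suc r) p ≤_) (+-comm r 1) (+-mono-≤ (count-≤ r p) (indicator-≤1 _))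

count-none : ∀ r p → (∀ j → InRange r j → ¬ T (p j)) → count r p ≡ 0
count-none zero    p none = refl
count-none (suc r) p none with p (suc r) in eq
... | true  = ⊥-elim (none (suc r) (InRange-last r) (subst T (sym eq) _))
... | false = trans (+-identityʳ _) (count-none r p (restrict none))

count-all : ∀ r p → (∀ j → InRange r j → T (p j)) → count r p ≡ r
count-all zero    p all = refl
count-all (suc r) p all with p (suc r) | all (suc r) (InRange-last r)
... | true | _ = trans (cong (_+ 1) (count-all r p (restrict all))) (+-comm r 1)

count-pos : ∀ r p k → InRange r k → T (p k) → 1 ≤ count r p
count-pos r p k k∈ pk =
  subst (λ c → suc c ≤ count r p) (count-none r (λ _ → false) (λ _ _ ()))
        (count-strict r (λ _ → false) p (λ _ _ ()) k k∈ (λ ()) pk)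

count-single : ∀ r p i → InRange r i → T (p i) → (∀ j → InRange r j → T (p j) → j ≡ i) → count r p ≡ 1
count-single zero    p i (() , z≤n) pi only
count-single (suc r) p i i∈ pi only with InRange-split i∈
... | inj₁ i≡r+1 = cong₂ _+_ (count-none r p (λ j j∈ pj → below j∈ (trans (only j (InRange-suc j∈) pj) i≡r+1)))
                              (cong indicator (T-ext _ true (λ _ → _) (λ _ → subst (T ∘ p) i≡r+1 pi)))
  where below : ∀ {j} → InRange r j → j ≢ suc r
        below (_ , j≤r) refl = 1+n≰n j≤r
... | inj₂ i∈′ with p (suc r) in eq
...   | true  = ⊥-elim (1+n≰n (subst (_≤ r) (sym (only (suc r) (InRange-last r) (subst T (sym eq) _))) (proj₂ i∈′)))
...   | false = trans (+-identityʳ _) (count-single r p i i∈′ pi (restrict only))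

count-front : ∀ r p → count (suc r) p ≡ indicator (p 1) + count r (λ j → p (suc j))
count-front zero    p = +-comm 0 (indicator (p 1))
count-front (suc r) p =
  trans (cong (_+ indicator (p (suc (suc r)))) (count-front r p)) (+-assoc (indicator (p 1)) _ _)

count-reverse : ∀ r p → count r (λ j → p (r + 1 ∸ j)) ≡ count r p
count-reverse zero    p = refl
count-reverse (suc r) p = begin
    count r (λ j → p (suc r + 1 ∸ j)) + indicator (p (suc r + 1 ∸ suc r))
  ≡⟨ cong₂ _+_ (count-cong r _ _ (λ j j∈ → cong p (shift j j∈)))
               (cong (λ z → indicator (p z)) (m+n∸m≡n (suc r) 1)) ⟩
    count r (λ j → p (suc (r + 1 ∸ j))) + indicator (p 1)
  ≡⟨ cong (_+ indicator (p 1)) (count-reverse r (λ j → p (suc j))) ⟩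
    count r (λ j → p (suc j)) + indicator (p 1)
  ≡⟨ +-comm _ (indicator (p 1)) ⟩
    indicator (p 1) + count r (λ j → p (suc j))
  ≡⟨ count-front r p ⟨
    count (suc r) p ∎
  where
  open ≡-Reasoning
  shift : ∀ j → InRange r j → suc r + 1 ∸ j ≡ suc (r + 1 ∸ j)
  shift j (_ , j≤r) = +-∸-assoc 1 (≤-trans j≤r (m≤m+n r 1))

indicator-∨∧ : ∀ a b → indicator a + indicator b ≡ indicator (a ∨ b) + indicator (a ∧ b)
indicator-∨∧ false false = refl
indicator-∨∧ false true  = refl
indicator-∨∧ true  false = refl
indicator-∨∧ true  true  = refl

count-∨∧ : ∀ r p q → count r p + count r q ≡ count r (λ j → p j ∨ q j) + count r (λ j → p j ∧ q j)
count-∨∧ zero    p q = refl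
count-∨∧ (suc r) p q = begin
    (count r p + P) + (count r q + Q)
  ≡⟨ interchange (count r p) P (count r q) Q ⟩
    (count r p + count r q) + (P + Q)
  ≡⟨ cong₂ _+_ (count-∨∧ r p q) (indicator-∨∧ (p (suc r)) (q (suc r))) ⟩
    (count r (λ j → p j ∨ q j) + count r (λ j → p j ∧ q j)) + (indicator (p (suc r) ∨ q (suc r)) + indicator (p (suc r) ∧ q (suc r)))
  ≡⟨ interchange (count r (λ j → p j ∨ q j)) _ _ _ ⟩
    count (suc r) (λ j → p j ∨ q j) + count (suc r) (λ j → p j ∧ q j) ∎
  where
  open ≡-Reasoning
  P Q : ℕ
  P = indicator (p (suc r))
  Q = indicator (q (suc r))

MapsInto : ℕ → (ℕ → ℕ) → Set
MapsInto r f = ∀ i → InRange r i → InRange r (f i)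

InjectiveOn : ℕ → (ℕ → ℕ) → Set
InjectiveOn r f = ∀ i j → InRange r i → InRange r j → f i ≡ f j → i ≡ j

-- Pigeonhole principle: an injective self-map of [1, r] is onto.
-- Induction on r: redirecting the value r + 1 to f (r + 1) gives an injective self-map of [1, r].
injective⇒onto : ∀ r f → MapsInto r f → InjectiveOn r f →
  ∀ v → InRange r v → ∃[ i ] (InRange r i × (f i ≡ v))
injective⇒onto zero    f into inj v (() , z≤n)
injective⇒onto (suc r) f into inj v v∈ = preimage (InRange-split v∈)
  where
  top : ℕ
  top = suc r
  top∈ : InRange (suc r) top
  top∈ = InRange-last r

  below : ∀ {i} → InRange r i → i ≢ top
  below (_ , i≤r) refl = 1+n≰n i≤r

  shrink : ∀ {i} → InRange (suc r) (f i) → f i ≢ top → InRange r (f i)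
  shrink fi∈ fi≢top with InRange-split fi∈
  ... | inj₁ fi≡top = ⊥-elim (fi≢top fi≡top)
  ... | inj₂ fi∈′   = fi∈′

  g : ℕ → ℕ
  g i with f i ≟ top
  ... | yes _ = f top
  ... | no  _ = f i

  g-into : MapsInto r g
  g-into i i∈ with f i ≟ top
  ... | yes fi≡top = shrink (into top top∈)
                       (λ ftop≡top → below i∈ (inj i top (InRange-suc i∈) top∈ (trans fi≡top (sym ftop≡top))))
  ... | no  fi≢top = shrink (into i (InRange-suc i∈)) fi≢top

  g-inj : InjectiveOn r g
  g-inj i j i∈ j∈ gi≡gj with f i ≟ top | f j ≟ top
  ... | yes fi≡top | yes fj≡top = inj i j (InRange-suc i∈) (InRange-suc j∈) (trans fi≡top (sym fj≡top))
  ... | yes _      | no  _      = ⊥-elim (below j∈ (sym (inj top j top∈ (InRange-suc j∈) gi≡gj)))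
  ... | no  _      | yes _      = ⊥-elim (below i∈ (inj i top (InRange-suc i∈) top∈ gi≡gj))
  ... | no  _      | no  _      = inj i j (InRange-suc i∈) (InRange-suc j∈) gi≡gj

  onto-g : ∀ w → InRange r w → ∃[ i ] (InRange r i × (g i ≡ w))
  onto-g = injective⇒onto r g g-into g-inj

  preimage : (v ≡ top) ⊎ InRange r v → ∃[ i ] (InRange (suc r) i × (f i ≡ v))
  preimage (inj₂ v∈′) with onto-g v v∈′
  ... | i , i∈ , gi≡v with f i ≟ top
  ...   | yes _ = top , top∈ , gi≡v
  ...   | no  _ = i , InRange-suc i∈ , gi≡v
  preimage (inj₁ refl) with f top ≟ top
  ... | yes ftop≡top = top , top∈ , ftop≡top
  ... | no  ftop≢top with onto-g (f top) (shrink (into top top∈) ftop≢top)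
  ...   | i , i∈ , gi≡ftop with f i ≟ top
  ...     | yes fi≡top = i , InRange-suc i∈ , fi≡top
  ...     | no  _      = ⊥-elim (below i∈ (inj i top (InRange-suc i∈) top∈ gi≡ftop))

Pattern123 : ℕ → (ℕ → ℕ) → ℕ → ℕ → ℕ → Set
Pattern123 r w i j k = (1 ≤ i) × (i < j) × (j < k) × (k ≤ r) × (w i < w j) × (w j < w k)

pattern-in-range : ∀ {r w i j k} → Pattern123 r w i j k → InRange r i × InRange r j × InRange r k
pattern-in-range (1≤i , i<j , j<k , k≤r , _) =
  (1≤i , ≤-trans (<⇒≤ (<-trans i<j j<k)) k≤r) ,
  (≤-trans 1≤i (<⇒≤ i<j) , ≤-trans (<⇒≤ j<k) k≤r) ,
  (≤-trans 1≤i (<⇒≤ (<-trans i<j j<k)) , k≤r)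

avoids-transfer : ∀ {r v w} → (∀ {x y} → InRange r x → InRange r y → v x < v y → w x < w y) →
  Avoids123 r w → Avoids123 r v
avoids-transfer v⇒w w-avoids (i , j , k , pat@(1≤i , i<j , j<k , k≤r , vi<vj , vj<vk))
  with pattern-in-range pat
... | i∈ , j∈ , k∈ = w-avoids (i , j , k , 1≤i , i<j , j<k , k≤r , v⇒w i∈ j∈ vi<vj , v⇒w j∈ k∈ vj<vk)

module _ (r : ℕ) (u : ℕ → ℕ) where

  rank : ℕ → ℕ
  rank v = countLeq r u v

  rank≡count : ∀ v → rank v ≡ count r (λ j → u j ≤ᵇ v)
  rank≡count = countLeq≡count r u

  rank-mono : ∀ {v w} → v ≤ w → rank v ≤ rank w
  rank-mono {v} {w} v≤w = subst₂ _≤_ (sym (rank≡count v)) (sym (rank≡count w))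
    (count-mono r _ _ (λ j _ uj≤v → ≤⇒≤ᵇ (≤-trans (≤ᵇ⇒≤ (u j) v uj≤v) v≤w)))

  -- (u j is counted in rank (u j) but not in rank v)
  rank-strict : ∀ {v j} → InRange r j → v < u j → rank v < rank (u j)
  rank-strict {v} {j} j∈ v<uj = subst₂ _<_ (sym (rank≡count v)) (sym (rank≡count (u j)))
    (count-strict r _ _ (λ k _ uk≤v → ≤⇒≤ᵇ (≤-trans (≤ᵇ⇒≤ (u k) v uk≤v) (<⇒≤ v<uj))) j j∈
                  (λ uj≤v → <⇒≱ v<uj (≤ᵇ⇒≤ (u j) v uj≤v)) (≤⇒≤ᵇ {u j} ≤-refl))

  module _ {τ : ℕ → ℕ} (iso : OrderIso r u τ) where

    orderIso-< : ∀ {x y} → InRange r x → InRange r y → u x < u y → τ x < τ y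
    orderIso-< {x} {y} (1≤x , x≤r) y∈@(1≤y , y≤r) ux<uy =
      subst₂ _<_ (iso x 1≤x x≤r) (iso y 1≤y y≤r) (rank-strict y∈ ux<uy)

    orderIso-<⁻ : ∀ {x y} → InRange r x → InRange r y → τ x < τ y → u x < u y
    orderIso-<⁻ {x} {y} (1≤x , x≤r) (1≤y , y≤r) τx<τy with u x <? u y
    ... | yes ux<uy = ux<uy
    ... | no  ux≮uy = ⊥-elim (<⇒≱ τx<τy
            (subst₂ _≤_ (iso y 1≤y y≤r) (iso x 1≤x x≤r) (rank-mono (≮⇒≥ ux≮uy))))

    orderIso-avoids : Avoids123 r u ⇔ Avoids123 r τ
    orderIso-avoids = mk⇔ (avoids-transfer orderIso-<⁻) (avoids-transfer orderIso-<)

standardize : ℕ → (ℕ → ℕ) → ℕ → ℕ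
standardize r u i = rank r u (u i)

standardize-orderIso : ∀ r u → OrderIso r u (standardize r u)
standardize-orderIso r u i _ _ = refl

standardize-perm : ∀ r u → InjectiveOn r u → IsPerm r (standardize r u)
standardize-perm r u u-inj = into′ , inj′ , onto′
  where
  τ : ℕ → ℕ
  τ = standardize r u
  into : MapsInto r τ
  into i (1≤i , i≤r) =
    subst (1 ≤_) (sym (rank≡count r u (u i))) (count-pos r _ i (1≤i , i≤r) (≤⇒≤ᵇ {u i} ≤-refl)) ,
    subst (_≤ r) (sym (rank≡count r u (u i))) (count-≤ r _)
  inj : InjectiveOn r τ
  inj i j i∈ j∈ τi≡τj with <-cmp (u i) (u j)
  ... | tri< ui<uj _ _ = ⊥-elim (<-irrefl τi≡τj (orderIso-< r u (standardize-orderIso r u) i∈ j∈ ui<uj))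
  ... | tri≈ _ ui≡uj _ = u-inj i j i∈ j∈ ui≡uj
  ... | tri> _ _ uj<ui = ⊥-elim (<-irrefl (sym τi≡τj) (orderIso-< r u (standardize-orderIso r u) j∈ i∈ uj<ui))
  into′ : ∀ i → 1 ≤ i → i ≤ r → (1 ≤ τ i) × (τ i ≤ r)
  into′ i 1≤i i≤r = into i (1≤i , i≤r)
  inj′ : ∀ i j → 1 ≤ i → i ≤ r → 1 ≤ j → j ≤ r → τ i ≡ τ j → i ≡ j
  inj′ i j 1≤i i≤r 1≤j j≤r = inj i j (1≤i , i≤r) (1≤j , j≤r)
  onto′ : ∀ v → 1 ≤ v → v ≤ r → ∃[ i ] ((1 ≤ i) × (i ≤ r) × (τ i ≡ v))
  onto′ v 1≤v v≤r with injective⇒onto r τ into inj v (1≤v , v≤r)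
  ... | i , (1≤i , i≤r) , τi≡v = i , 1≤i , i≤r , τi≡v

mirror-≤ : ∀ {a a′ b b′ K} → a + a′ ≡ K → b + b′ ≡ K → a ≤ b → b′ ≤ a′
mirror-≤ a+a′≡K b+b′≡K a≤b = +-complement-≤ (trans b+b′≡K (sym a+a′≡K)) a≤b

-- If the word is symmetric in the sense u(i) + u(r + 1 - i) = K, its standardization is
-- centrosymmetric: rank(u i) + rank(u(r+1-i)) counts the j with u j ≤ u i plus those with
-- u j ≥ u i, which is every position once and i itself twice.
standardize-centro : ∀ r u K → InjectiveOn r u →
  (∀ i → InRange r i → u i + u (r + 1 ∸ i) ≡ K) → Centrosymmetric r (standardize r u)
standardize-centro r u K u-inj mirror i 1≤i i≤r = begin
    rank r u (u i) + rank r u (u i′)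
  ≡⟨ cong₂ _+_ (rank≡count r u (u i)) (rank≡count r u (u i′)) ⟩
    count r below + count r (λ j → u j ≤ᵇ u i′)
  ≡⟨ cong (count r below +_) (count-reverse r (λ j → u j ≤ᵇ u i′)) ⟨
    count r below + count r (λ j → u (r + 1 ∸ j) ≤ᵇ u i′)
  ≡⟨ cong (count r below +_) (count-cong r _ above reflect) ⟩
    count r below + count r above
  ≡⟨ count-∨∧ r below above ⟩
    count r (λ j → below j ∨ above j) + count r (λ j → below j ∧ above j)
  ≡⟨ cong₂ _+_ (count-all r _ λ j _ → comparable j)
               (count-single r _ i i∈ (Equivalence.from T-∧ (≤⇒≤ᵇ {u i} ≤-refl , ≤⇒≤ᵇ {u i} ≤-refl)) only-i) ⟩
    r + 1 ∎
  where
  open ≡-Reasoning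
  i′ : ℕ
  i′ = r + 1 ∸ i
  i∈ : InRange r i
  i∈ = (1≤i , i≤r)
  below above : ℕ → Bool
  below j = u j ≤ᵇ u i
  above j = u i ≤ᵇ u j
  flip : ∀ {j} → InRange r j → u (r + 1 ∸ j) + u j ≡ K
  flip {j} j∈ = trans (+-comm _ (u j)) (mirror j j∈)
  reflect : ∀ j → InRange r j → (u (r + 1 ∸ j) ≤ᵇ u i′) ≡ above j
  reflect j j∈ = T-ext _ _
    (λ h → ≤⇒≤ᵇ {u i} (mirror-≤ (flip j∈) (flip i∈) (≤ᵇ⇒≤ (u (r + 1 ∸ j)) (u i′) h)))
    (λ h → ≤⇒≤ᵇ {u (r + 1 ∸ j)} (mirror-≤ (mirror i i∈) (mirror j j∈) (≤ᵇ⇒≤ (u i) (u j) h)))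
  comparable : ∀ j → T (below j ∨ above j)
  comparable j with ≤-total (u j) (u i)
  ... | inj₁ uj≤ui = Equivalence.from T-∨ (inj₁ (≤⇒≤ᵇ uj≤ui))
  ... | inj₂ ui≤uj = Equivalence.from T-∨ (inj₂ (≤⇒≤ᵇ ui≤uj))
  only-i : ∀ j → InRange r j → T (below j ∧ above j) → j ≡ i
  only-i j j∈ h with Equivalence.to T-∧ h
  ... | uj≤ui , ui≤uj = u-inj j i j∈ i∈ (≤-antisym (≤ᵇ⇒≤ (u j) (u i) uj≤ui) (≤ᵇ⇒≤ (u i) (u j) ui≤uj))

module Setting (n : ℕ) (1≤n : 1 ≤ n) (σ : ℕ → ℕ) (perm : IsPerm (2 * n) σ)
               (centro : Centrosymmetric (2 * n) σ) (l : ℕ) (w₁ : IsW1Length σ n l) where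

  -- σ has length m; σ′ has length r and occupies the positions l + 2, …, A.
  m r A : ℕ
  m = 2 * n
  r = 2 * n ∸ 2 * l ∸ 2
  A = l + 1 + r

  σ′ : ℕ → ℕ
  σ′ i = σ (l + 1 + i)

  σ-into : ∀ i → InRange m i → InRange m (σ i)
  σ-into i (1≤i , i≤m) = proj₁ perm i 1≤i i≤m

  σ-inj : InjectiveOn m σ
  σ-inj i j (1≤i , i≤m) (1≤j , j≤m) = proj₁ (proj₂ perm) i j 1≤i i≤m 1≤j j≤m

  σ-onto : ∀ v → InRange m v → ∃[ p ] (InRange m p × (σ p ≡ v))
  σ-onto v (1≤v , v≤m) with proj₂ (proj₂ perm) v 1≤v v≤m
  ... | p , 1≤p , p≤m , σp≡v = p , (1≤p , p≤m) , σp≡v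

  l+1≤n : l + 1 ≤ n
  l+1≤n = proj₁ w₁

  m≡A+l+1 : m ≡ A + (l + 1)
  m≡A+l+1 = begin
      2 * n                           ≡⟨ m+[n∸m]≡n 2l+2≤m ⟨
      (2 * l + 2) + (2 * n ∸ (2 * l + 2)) ≡⟨ cong ((2 * l + 2) +_) (∸-+-assoc (2 * n) (2 * l) 2) ⟨
      (2 * l + 2) + r                 ≡⟨ regroup l r ⟩
      A + (l + 1)                     ∎
    where
    open ≡-Reasoning
    double : ∀ l → 2 * (l + 1) ≡ 2 * l + 2
    double = solve-∀
    regroup : ∀ l r → (2 * l + 2) + r ≡ l + 1 + r + (l + 1)
    regroup = solve-∀
    2l+2≤m : 2 * l + 2 ≤ 2 * n
    2l+2≤m = subst (_≤ 2 * n) (double l) (*-monoʳ-≤ 2 l+1≤n)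

  A≤m : A ≤ m
  A≤m = subst (A ≤_) (sym m≡A+l+1) (m≤m+n A (l + 1))

  l+1≤m : l + 1 ≤ m
  l+1≤m = ≤-trans (m≤m+n (l + 1) r) A≤m

  l≤m : l ≤ m
  l≤m = ≤-trans (m≤m+n l 1) l+1≤m

  n≤m : n ≤ m
  n≤m = m≤m+n n (n + 0)

  1≤m : 1 ≤ m
  1≤m = ≤-trans 1≤n n≤m

  r≡0-if-w₁-ends : l + 1 ≡ n → r ≡ 0
  r≡0-if-w₁-ends l+1≡n = begin
      2 * n ∸ 2 * l ∸ 2           ≡⟨ cong (λ x → 2 * x ∸ 2 * l ∸ 2) l+1≡n ⟨
      2 * (l + 1) ∸ 2 * l ∸ 2     ≡⟨ cong (λ x → x ∸ 2 * l ∸ 2) (*-distribˡ-+ 2 l 1) ⟩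
      (2 * l + 2) ∸ 2 * l ∸ 2     ≡⟨ cong (_∸ 2) (m+n∸m≡n (2 * l) 2) ⟩
      0                           ∎
    where open ≡-Reasoning

  mirror-pair : ∀ p q → InRange m p → p + q ≡ m + 1 → σ p + σ q ≡ m + 1
  mirror-pair p q (1≤p , p≤m) p+q≡ =
    subst (λ z → σ p + σ z ≡ m + 1) (trans (cong (_∸ p) (sym p+q≡)) (m+n∸m≡n p q)) (centro p 1≤p p≤m)

  first+last : σ 1 + σ m ≡ m + 1
  first+last = mirror-pair 1 m (s≤s z≤n , 1≤m) (+-comm 1 m)

  mirror-sum : ∀ {q} → q ≤ m → q + (m + 1 ∸ q) ≡ m + 1
  mirror-sum q≤m = m+[n∸m]≡n (≤-trans q≤m (m≤m+n m 1))

  mirror-range : ∀ {q} → InRange m q → InRange m (m + 1 ∸ q)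
  mirror-range (1≤q , q≤m) =
    +-complement-≤ (sym (mirror-sum q≤m)) q≤m ,
    +-complement-≤ (trans (mirror-sum q≤m) (+-comm m 1)) 1≤q

  -- (i) If x₁ < n then the value x₁ + 1 lies strictly between positions 1 and m, and
  -- σ(m) = m + 1 - x₁ > x₁ + 1, so σ(1), x₁ + 1, σ(m) is a 123 pattern.
  first≥n : Avoids123 m σ → n ≤ σ 1
  first≥n avoids = ≮⇒≥ λ x₁<n → value-after-x₁ x₁<n (σ-onto (suc (σ 1)) (s≤s z≤n , ≤-trans x₁<n n≤m))
    where
    double : ∀ n → 2 * n + 1 ≡ n + n + 1
    double = solve-∀
    next<last : σ 1 < n → suc (σ 1) < σ m
    next<last x₁<n = +-cancelˡ-≤ (σ 1) _ _ (begin
        σ 1 + suc (suc (σ 1)) ≡⟨ +-suc (σ 1) (suc (σ 1)) ⟩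
        suc (σ 1) + suc (σ 1) ≤⟨ +-mono-≤ x₁<n x₁<n ⟩
        n + n                 ≤⟨ m≤m+n (n + n) 1 ⟩
        n + n + 1             ≡⟨ double n ⟨
        m + 1                 ≡⟨ first+last ⟨
        σ 1 + σ m             ∎)
      where open ≤-Reasoning
    value-after-x₁ : σ 1 < n → ¬ (∃[ p ] (InRange m p × (σ p ≡ suc (σ 1))))
    value-after-x₁ x₁<n (p , (1≤p , p≤m) , σp≡) =
      avoids (1 , p , m , ≤-refl , 1<p , p<m , ≤-refl , x₁<σp , σp<σm)
      where
      x₁<σp : σ 1 < σ p
      x₁<σp = subst (σ 1 <_) (sym σp≡) ≤-refl
      σp<σm : σ p < σ m
      σp<σm = subst (_< σ m) (sym σp≡) (next<last x₁<n)
      1<p : 1 < p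
      1<p = ≤∧≢⇒< 1≤p (λ 1≡p → <-irrefl (cong σ 1≡p) x₁<σp)
      p<m : p < m
      p<m = ≤∧≢⇒< p≤m (λ p≡m → <-irrefl (cong σ p≡m) σp<σm)

  w₁-position : ∀ {k} → k < l → (2 ≤ k + 2) × (k + 2 ≤ l + 1)
  w₁-position {k} k<l = m≤n+m 2 k , subst (_≤ l + 1) (sym (+-suc k 1)) (+-monoˡ-≤ 1 k<l)

  w₁-position∈ : ∀ {k} → k < l → InRange m (k + 2)
  w₁-position∈ k<l =
    ≤-trans (s≤s z≤n) (proj₁ (w₁-position k<l)) , ≤-trans (proj₂ (w₁-position k<l)) l+1≤m

  offset-2 : ∀ {p t} → 2 ≤ p → p < t + 2 → (p ∸ 2 < t) × (p ∸ 2 + 2 ≡ p)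
  offset-2 {p} {t} 2≤p p<t+2 =
    subst (p ∸ 2 <_) (m+n∸n≡m t 2) (∸-monoˡ-< p<t+2 2≤p) , m∸n+n≡m 2≤p

  -- Every entry of w₁ exceeds x₁: otherwise the first entry of w₁ not exceeding x₁
  -- would be a left-to-right minimum.
  w₁-above-x₁ : ∀ j → 2 ≤ j → j ≤ l + 1 → σ 1 < σ j
  w₁-above-x₁ = <-rec (λ j → 2 ≤ j → j ≤ l + 1 → σ 1 < σ j) step
    where
    step : ∀ j → (∀ {i} → i < j → 2 ≤ i → i ≤ l + 1 → σ 1 < σ i) → 2 ≤ j → j ≤ l + 1 → σ 1 < σ j
    step j ih 2≤j j≤l+1 with σ 1 <? σ j
    ... | yes x₁<σj = x₁<σj
    ... | no  x₁≮σj = ⊥-elim (proj₁ (proj₂ w₁) j 2≤j j≤l+1 is-min)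
      where
      is-min : LRMin σ j
      is-min i 1≤i i≤j with m≤n⇒m<n∨m≡n i≤j
      ... | inj₂ refl = ≤-refl
      ... | inj₁ i<j with m≤n⇒m<n∨m≡n 1≤i
      ...   | inj₂ refl = ≮⇒≥ x₁≮σj
      ...   | inj₁ 1<i  = <⇒≤ (≤-<-trans (≮⇒≥ x₁≮σj) (ih i<j 1<i (≤-trans (<⇒≤ i<j) j≤l+1)))

  TopPrefix : ℕ → Set
  TopPrefix k = ∀ k′ → k′ < k → σ (k′ + 2) ≡ m ∸ k′

  above-top-prefix : ∀ {k} → k ≤ l → TopPrefix k → ∀ q → InRange m q → m ∸ k < σ q → q < k + 2
  above-top-prefix {k} k≤l top q q∈ m∸k<σq =
    subst (_< k + 2) (σ-inj _ _ (w₁-position∈ k′<l) q∈ σk′+2≡σq) (+-monoˡ-< 2 k′<k)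
    where
    σq≤m : σ q ≤ m
    σq≤m = proj₂ (σ-into q q∈)
    k′ : ℕ
    k′ = m ∸ σ q
    k′<k : k′ < k
    k′<k = subst (k′ <_) (m∸[m∸n]≡n (≤-trans k≤l l≤m)) (∸-monoʳ-< m∸k<σq σq≤m)
    k′<l : k′ < l
    k′<l = <-≤-trans k′<k k≤l
    σk′+2≡σq : σ (k′ + 2) ≡ σ q
    σk′+2≡σq = trans (top k′ k′<k) (m∸[m∸n]≡n σq≤m)

  top-prefix-excludes : ∀ {k} → k < l → TopPrefix k → ∀ p → 2 ≤ p → p < k + 2 → σ p ≢ m ∸ k
  top-prefix-excludes {k} k<l top p 2≤p p<k+2 σp≡m∸k with offset-2 2≤p p<k+2
  ... | k′<k , k′+2≡p = <-irrefl (∸-cancelˡ-≡ k′≤m k≤m (trans (sym (top _ k′<k)) (trans (cong σ k′+2≡p) σp≡m∸k))) k′<k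
    where
    k≤m : k ≤ m
    k≤m = ≤-trans (<⇒≤ k<l) l≤m
    k′≤m : p ∸ 2 ≤ m
    k′≤m = ≤-trans (<⇒≤ k′<k) k≤m

  -- (ii) w₁ = m (m - 1) ⋯ (m - l + 1), by strong induction on the position: the value m - k
  -- is not at the positions 1, …, k + 1, it is not smaller than σ(k + 2), and if it came later
  -- then σ(1), σ(k + 2), m - k would be a 123 pattern.
  w₁-top : Avoids123 m σ → TopPrefix l
  w₁-top avoids = <-rec (λ k → k < l → σ (k + 2) ≡ m ∸ k) step
    where
    step : ∀ k → (∀ {k′} → k′ < k → k′ < l → σ (k′ + 2) ≡ m ∸ k′) → k < l → σ (k + 2) ≡ m ∸ k
    step k ih k<l = ≤-antisym σk+2≤m∸k (≮⇒≥ not-below)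
      where
      top : TopPrefix k
      top k′ k′<k = ih k′<k (<-trans k′<k k<l)
      k+2∈ : InRange m (k + 2)
      k+2∈ = w₁-position∈ k<l
      x₁<σk+2 : σ 1 < σ (k + 2)
      x₁<σk+2 = w₁-above-x₁ (k + 2) (proj₁ (w₁-position k<l)) (proj₂ (w₁-position k<l))
      σk+2≤m∸k : σ (k + 2) ≤ m ∸ k
      σk+2≤m∸k = ≮⇒≥ λ m∸k<σ → <-irrefl refl (above-top-prefix (<⇒≤ k<l) top (k + 2) k+2∈ m∸k<σ)
      m∸k∈ : InRange m (m ∸ k)
      m∸k∈ = m<n⇒0<n∸m (<-≤-trans k<l l≤m) , m∸n≤m m k
      not-below : ¬ σ (k + 2) < m ∸ k
      not-below σk+2<m∸k with σ-onto (m ∸ k) m∸k∈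
      ... | p , p∈@(1≤p , p≤m) , σp≡m∸k with <-cmp p (k + 2)
      ...   | tri≈ _ p≡k+2 _ = <-irrefl (trans (cong σ (sym p≡k+2)) σp≡m∸k) σk+2<m∸k
      ...   | tri> _ _ k+2<p = avoids (1 , k + 2 , p , ≤-refl , proj₁ (w₁-position k<l) , k+2<p , p≤m ,
                                       x₁<σk+2 , subst (σ (k + 2) <_) (sym σp≡m∸k) σk+2<m∸k)
      ...   | tri< p<k+2 _ _ with m≤n⇒m<n∨m≡n 1≤p
      ...     | inj₂ 1≡p = <-asym x₁<σk+2 (subst (σ (k + 2) <_) (sym (trans (cong σ 1≡p) σp≡m∸k)) σk+2<m∸k)
      ...     | inj₁ 1<p = top-prefix-excludes k<l top p 1<p p<k+2 σp≡m∸k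

  first<m+1∸ : Avoids123 m σ → ∀ t → t ≤ l → σ 1 < m + 1 ∸ t
  first<m+1∸ avoids zero    _   = ≤-<-trans (proj₂ (σ-into 1 (s≤s z≤n , 1≤m))) (m<m+n m (s≤s z≤n))
  first<m+1∸ avoids (suc t) t<l =
    subst (σ 1 <_) (trans (w₁-top avoids t t<l) (cong (_∸ suc t) (+-comm 1 m)))
          (w₁-above-x₁ (t + 2) (proj₁ (w₁-position t<l)) (proj₂ (w₁-position t<l)))

  l+1+1≡l+2 : l + 1 + 1 ≡ l + 2
  l+1+1≡l+2 = +-assoc l 1 1

  σ′-position : ∀ {i} → InRange r i → InRange m (l + 1 + i)
  σ′-position {i} (1≤i , i≤r) = ≤-trans 1≤i (m≤n+m i (l + 1)) , ≤-trans (+-monoʳ-≤ (l + 1) i≤r) A≤m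

  -- (iv) If σ′ is nonempty, x₂ = σ(l + 2) is the next left-to-right minimum, hence below x₁.
  next-below-first : 1 ≤ r → σ (l + 2) < σ 1
  next-below-first 1≤r with proj₂ (proj₂ w₁)
  ... | inj₁ l+1≡n  = ⊥-elim (<-irrefl (sym (r≡0-if-w₁-ends l+1≡n)) 1≤r)
  ... | inj₂ x₂-min = ≤∧≢⇒< (x₂-min 1 (s≤s z≤n) (≤-trans (s≤s z≤n) 2≤l+2)) x₂≢x₁
    where
    2≤l+2 : 2 ≤ l + 2
    2≤l+2 = m≤n+m 2 l
    l+2∈ : InRange m (l + 2)
    l+2∈ = subst (InRange m) l+1+1≡l+2 (σ′-position (≤-refl , 1≤r))
    x₂≢x₁ : σ (l + 2) ≢ σ 1
    x₂≢x₁ eq = 1+n≰n (≤-trans 2≤l+2 (≤-reflexive (σ-inj _ _ l+2∈ (s≤s z≤n , 1≤m) eq)))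

  σ′-inj : InjectiveOn r σ′
  σ′-inj i j i∈ j∈ σ′i≡σ′j = +-cancelˡ-≡ (l + 1) i j (σ-inj _ _ (σ′-position i∈) (σ′-position j∈) σ′i≡σ′j)

  σ′-mirror : ∀ i → InRange r i → σ′ i + σ′ (r + 1 ∸ i) ≡ m + 1
  σ′-mirror i i∈@(_ , i≤r) = mirror-pair (l + 1 + i) (l + 1 + i′) (σ′-position i∈) (begin
      (l + 1 + i) + (l + 1 + i′) ≡⟨ regroup (l + 1) i i′ ⟩
      (l + 1 + (l + 1)) + (i + i′) ≡⟨ cong ((l + 1 + (l + 1)) +_) (m+[n∸m]≡n (≤-trans i≤r (m≤m+n r 1))) ⟩
      (l + 1 + (l + 1)) + (r + 1) ≡⟨ regroup′ (l + 1) r ⟩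
      A + (l + 1) + 1             ≡⟨ cong (_+ 1) m≡A+l+1 ⟨
      m + 1                       ∎)
    where
    open ≡-Reasoning
    i′ : ℕ
    i′ = r + 1 ∸ i
    regroup : ∀ a i i′ → (a + i) + (a + i′) ≡ (a + a) + (i + i′)
    regroup = solve-∀
    regroup′ : ∀ a r → (a + a) + (r + 1) ≡ a + r + a + 1
    regroup′ = solve-∀

  σ′-avoids : Avoids123 m σ → Avoids123 r σ′
  σ′-avoids avoids (i , j , k , pat@(1≤i , i<j , j<k , k≤r , σ′i<σ′j , σ′j<σ′k)) with pattern-in-range pat
  ... | i∈ , _ , k∈ = avoids (l + 1 + i , l + 1 + j , l + 1 + k , proj₁ (σ′-position i∈) ,
                              +-monoʳ-< (l + 1) i<j , +-monoʳ-< (l + 1) j<k , proj₂ (σ′-position k∈) ,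
                              σ′i<σ′j , σ′j<σ′k)

  module Converse (top : TopPrefix l) (next : 1 ≤ r → σ (l + 2) < σ 1) where

    -- Nothing after an entry of w₁ is larger: all larger values sit earlier in w₁.
    w₁-no-larger-later : ∀ p q → 2 ≤ p → p < l + 2 → InRange m q → σ p < σ q → q < p
    w₁-no-larger-later p q 2≤p p<l+2 q∈ σp<σq with offset-2 2≤p p<l+2
    ... | k<l , k+2≡p = subst (q <_) k+2≡p
            (above-top-prefix (<⇒≤ k<l) (λ k′ k′<k → top k′ (<-trans k′<k k<l)) q q∈
               (subst (_< σ q) (trans (cong σ (sym k+2≡p)) (top _ k<l)) σp<σq))

    -- Mirror image: nothing before an entry at positions A + 1, …, m - 1 is smaller.
    tail-no-smaller-earlier : ∀ p q → A < p → p < m → InRange m q → σ q < σ p → p < q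
    tail-no-smaller-earlier p q A<p p<m q∈@(_ , q≤m) σq<σp =
      +-complement-< (trans (+-comm p′ p) (trans (mirror-sum p≤m) (sym (trans (+-comm q′ q) (mirror-sum q≤m))))) q′<p′
      where
      p≤m : p ≤ m
      p≤m = <⇒≤ p<m
      p′ q′ : ℕ
      p′ = m + 1 ∸ p
      q′ = m + 1 ∸ q
      2≤p′ : 2 ≤ p′
      2≤p′ = +-complement-< (sym (mirror-sum p≤m)) p<m
      p′<l+2 : p′ < l + 2
      p′<l+2 = +-complement-< (trans (mirror-sum p≤m) (begin
          m + 1             ≡⟨ cong (_+ 1) m≡A+l+1 ⟩
          A + (l + 1) + 1   ≡⟨ +-assoc A (l + 1) 1 ⟩
          A + (l + 1 + 1)   ≡⟨ cong (A +_) l+1+1≡l+2 ⟩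
          A + (l + 2)       ∎)) A<p
        where open ≡-Reasoning
      σp′<σq′ : σ p′ < σ q′
      σp′<σq′ = +-complement-< (trans (mirror-pair p p′ (≤-trans (s≤s z≤n) (≤-trans (s≤s z≤n) A<p) , p≤m) (mirror-sum p≤m))
                                      (sym (mirror-pair q q′ q∈ (mirror-sum q≤m)))) σq<σp
      q′<p′ : q′ < p′
      q′<p′ = w₁-no-larger-later p′ q′ 2≤p′ p′<l+2 (mirror-range q∈) σp′<σq′

    middle-in-σ′ : ∀ {i j k} → Pattern123 m σ i j k → (l + 2 ≤ j) × (j ≤ A)
    middle-in-σ′ pat@(1≤i , i<j , j<k , k≤m , σi<σj , σj<σk) with pattern-in-range pat
    ... | i∈ , _ , k∈ =
      ≮⇒≥ (λ j<l+2 → <-asym j<k (w₁-no-larger-later _ _ (≤-trans (s≤s 1≤i) i<j) j<l+2 k∈ σj<σk)) ,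
      ≮⇒≥ (λ A<j → <-asym i<j (tail-no-smaller-earlier _ _ A<j (<-≤-trans j<k k≤m) i∈ σi<σj))

    first-in-σ′ : ∀ {i j k} → Pattern123 m σ i j k → (i ≡ 1) ⊎ (l + 2 ≤ i)
    first-in-σ′ pat@(1≤i , i<j , _ , _ , σi<σj , _) with m≤n⇒m<n∨m≡n 1≤i
    ... | inj₂ 1≡i = inj₁ (sym 1≡i)
    ... | inj₁ 1<i = inj₂ (≮⇒≥ λ i<l+2 →
            <-asym i<j (w₁-no-larger-later _ _ 1<i i<l+2 (proj₁ (proj₂ (pattern-in-range pat))) σi<σj))

    last-in-σ′ : ∀ {i j k} → Pattern123 m σ i j k → (k ≡ m) ⊎ (k ≤ A)
    last-in-σ′ pat@(_ , _ , j<k , k≤m , _ , σj<σk) with m≤n⇒m<n∨m≡n k≤m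
    ... | inj₂ k≡m = inj₁ k≡m
    ... | inj₁ k<m = inj₂ (≮⇒≥ λ A<k →
            <-asym j<k (tail-no-smaller-earlier _ _ A<k k<m (proj₁ (proj₂ (pattern-in-range pat))) σj<σk))

    nonempty : ∀ {j} → l + 2 ≤ j → j ≤ A → 1 ≤ r
    nonempty l+2≤j j≤A = +-cancelˡ-≤ (l + 1) 1 r (subst (_≤ A) (sym l+1+1≡l+2) (≤-trans l+2≤j j≤A))

    -- A first entry x₁ may be replaced by the smaller x₂ = σ(l + 2), the first entry of σ′.
    lower-into-σ′ : ∀ {i j} → l + 2 ≤ j → j ≤ A → (i ≡ 1) ⊎ (l + 2 ≤ i) → i < j → σ i < σ j →
                    ∃[ i′ ] ((l + 2 ≤ i′) × (i′ < j) × (σ i′ < σ j))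
    lower-into-σ′ _ _ (inj₂ l+2≤i) i<j σi<σj = _ , l+2≤i , i<j , σi<σj
    lower-into-σ′ {j = j} l+2≤j j≤A (inj₁ refl) _ x₁<σj =
      l + 2 , ≤-refl , ≤∧≢⇒< l+2≤j (λ l+2≡j → <-irrefl (cong σ l+2≡j) x₂<σj) , x₂<σj
      where
      x₂<σj : σ (l + 2) < σ j
      x₂<σj = <-trans (next (nonempty l+2≤j j≤A)) x₁<σj

    -- A last entry σ(m) = m + 1 - x₁ may be replaced by the larger σ(A) = m + 1 - x₂,
    -- the last entry of σ′.
    raise-into-σ′ : ∀ {j k} → l + 2 ≤ j → j ≤ A → (k ≡ m) ⊎ (k ≤ A) → j < k → σ j < σ k →
                    ∃[ k′ ] ((j < k′) × (k′ ≤ A) × (σ j < σ k′))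
    raise-into-σ′ _ _ (inj₂ k≤A) j<k σj<σk = _ , j<k , k≤A , σj<σk
    raise-into-σ′ {j} l+2≤j j≤A (inj₁ refl) _ σj<σm =
      A , ≤∧≢⇒< j≤A (λ j≡A → <-irrefl (cong σ j≡A) σj<σA) , ≤-refl , σj<σA
      where
      l+2+A≡m+1 : l + 2 + A ≡ m + 1
      l+2+A≡m+1 = begin
        l + 2 + A         ≡⟨ +-comm (l + 2) A ⟩
        A + (l + 2)       ≡⟨ cong (A +_) l+1+1≡l+2 ⟨
        A + (l + 1 + 1)   ≡⟨ +-assoc A (l + 1) 1 ⟨
        A + (l + 1) + 1   ≡⟨ cong (_+ 1) m≡A+l+1 ⟨
        m + 1             ∎
        where open ≡-Reasoning
      l+2∈ : InRange m (l + 2)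
      l+2∈ = ≤-trans (s≤s z≤n) (m≤n+m 2 l) , ≤-trans (≤-trans l+2≤j j≤A) A≤m
      σm<σA : σ m < σ A
      σm<σA = +-complement-< (trans first+last (sym (mirror-pair (l + 2) A l+2∈ l+2+A≡m+1)))
                             (next (nonempty l+2≤j j≤A))
      σj<σA : σ j < σ A
      σj<σA = <-trans σj<σm σm<σA

    σ′-pattern : ∀ {i j k} → l + 2 ≤ i → i < j → j < k → k ≤ A → σ i < σ j → σ j < σ k → ¬ Avoids123 r σ′
    σ′-pattern {i} {j} {k} l+2≤i i<j j<k k≤A σi<σj σj<σk σ′-avoids =
      σ′-avoids (i ∸ (l + 1) , j ∸ (l + 1) , k ∸ (l + 1) , 1≤i′ , ∸-monoˡ-< i<j l+1≤i , ∸-monoˡ-< j<k l+1≤j ,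
                 k′≤r , subst₂ _<_ (cong σ (sym (shift l+1≤i))) (cong σ (sym (shift l+1≤j))) σi<σj ,
                 subst₂ _<_ (cong σ (sym (shift l+1≤j))) (cong σ (sym (shift l+1≤k))) σj<σk)
      where
      shift : ∀ {p} → l + 1 ≤ p → l + 1 + (p ∸ (l + 1)) ≡ p
      shift = m+[n∸m]≡n
      l+1≤i : l + 1 ≤ i
      l+1≤i = ≤-trans (≤-trans (m≤m+n (l + 1) 1) (≤-reflexive l+1+1≡l+2)) l+2≤i
      l+1≤j : l + 1 ≤ j
      l+1≤j = ≤-trans l+1≤i (<⇒≤ i<j)
      l+1≤k : l + 1 ≤ k
      l+1≤k = ≤-trans l+1≤j (<⇒≤ j<k)
      1≤i′ : 1 ≤ i ∸ (l + 1)
      1≤i′ = subst (_≤ i ∸ (l + 1)) (m+n∸m≡n (l + 1) 1)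
                   (∸-monoˡ-≤ (l + 1) (≤-trans (≤-reflexive l+1+1≡l+2) l+2≤i))
      k′≤r : k ∸ (l + 1) ≤ r
      k′≤r = subst (k ∸ (l + 1) ≤_) (m+n∸m≡n (l + 1) r) (∸-monoˡ-≤ (l + 1) k≤A)

    avoids : Avoids123 r σ′ → Avoids123 m σ
    avoids σ′-avoids (i , j , k , pat@(_ , i<j , j<k , _ , σi<σj , σj<σk)) with middle-in-σ′ pat
    ... | l+2≤j , j≤A with lower-into-σ′ l+2≤j j≤A (first-in-σ′ pat) i<j σi<σj
                         | raise-into-σ′ l+2≤j j≤A (last-in-σ′ pat) j<k σj<σk
    ... | i′ , l+2≤i′ , i′<j , σi′<σj | k′ , j<k′ , k′≤A , σj<σk′ =
      σ′-pattern l+2≤i′ i′<j j<k′ k′≤A σi′<σj σj<σk′ σ′-avoids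

  Conditions : Set
  Conditions = (n ≤ σ 1) × (TopPrefix l × (σ 1 < m + 1 ∸ l)) ×
               (∃[ τ ] (IsPerm r τ × Centrosymmetric r τ × Avoids123 r τ × OrderIso r σ′ τ)) ×
               (1 ≤ r → σ (l + 2) < σ 1)

  -- For (iii), τ is the standardization of σ′, which avoids 123 since σ′ does.
  avoids⇒conditions : Avoids123 m σ → Conditions
  avoids⇒conditions σ-avoids =
    first≥n σ-avoids ,
    (w₁-top σ-avoids , first<m+1∸ σ-avoids l ≤-refl) ,
    (standardize r σ′ , standardize-perm r σ′ σ′-inj ,
     standardize-centro r σ′ (m + 1) σ′-inj σ′-mirror ,
     Equivalence.to (orderIso-avoids r σ′ (standardize-orderIso r σ′)) (σ′-avoids σ-avoids) ,
     standardize-orderIso r σ′) ,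
    next-below-first

  -- Only (ii), (iii) and (iv) are needed here: σ′ avoids 123 as τ does.
  conditions⇒avoids : Conditions → Avoids123 m σ
  conditions⇒avoids (_ , (top , _) , (τ , _ , _ , τ-avoids , iso) , next) =
    Converse.avoids top next (Equivalence.from (orderIso-avoids r σ′ iso) τ-avoids)

proposition4 : ∀ (n : ℕ) → 1 ≤ n → (σ : ℕ → ℕ) →
    IsPerm (2 * n) σ → Centrosymmetric (2 * n) σ →
    ∀ (l₁ : ℕ) → IsW1Length σ n l₁ →
    Avoids123 (2 * n) σ ⇔
      ((n ≤ σ 1) ×
       ((∀ k → k < l₁ → σ (k + 2) ≡ 2 * n ∸ k) × (σ 1 < 2 * n + 1 ∸ l₁)) ×
       (∃[ τ ] (IsPerm (2 * n ∸ 2 * l₁ ∸ 2) τ ×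
                Centrosymmetric (2 * n ∸ 2 * l₁ ∸ 2) τ ×
                Avoids123 (2 * n ∸ 2 * l₁ ∸ 2) τ ×
                OrderIso (2 * n ∸ 2 * l₁ ∸ 2) (λ i → σ (l₁ + 1 + i)) τ)) ×
       (1 ≤ 2 * n ∸ 2 * l₁ ∸ 2 → σ (l₁ + 2) < σ 1))
proposition4 n 1≤n σ perm centro l₁ w₁ = mk⇔ avoids⇒conditions conditions⇒avoids
  where open Setting n 1≤n σ perm centro l₁ w₁
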